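{- Let $n\geqslant 2$ and let $k$ be odd with $1\leqslant k<n$. Then the map $\phi:V(\text{CQ}_n)\to V(\text{CQ}_n)$, $\phi(u)=f_k(u)$, is an automorphism of $\text{CQ}_n$.
   Context: Two 2-bit strings $x_2x_1$ and $y_2y_1$ are pair related, written $x_2x_1\sim y_2y_1$, iff $(x_2x_1,y_2y_1)\in\{(00,00),(10,10),(01,11),(11,01)\}$. The $n$-dimensional crossed cube $\text{CQ}_n$ has as vertices all binary strings $u=u_{n-1}\ldots u_0$ of length $n$. Two vertices $u,v$ are adjacent iff there is an index $x$ with $0\leqslant x\leqslant n-1$ such that: (1) $v_x\neq u_x$; (2) if $x$ is odd, $v_{x-1}=u_{x-1}$; (3) $v_i=u_i$ for all $i>x$; (4) $u_{2i+1}u_{2i}\sim v_{2i+1}v_{2i}$ for all $0\leqslant i\leqslant\lfloor x/2\rfloor-1$. For $0\leqslant i\leqslant n-1$, $f_i(u)$ denotes the string obtained from $u$ by negating the bit $u_i$. -}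

module Defs where

open import Data.Nat using (ℕ; zero; suc; _+_; _*_; _<_; _≤_; _/_)
open import Data.Bool using (Bool; true; false; not)
open import Data.Fin using (Fin; toℕ; fromℕ<)
open import Data.Vec using (Vec; lookup; updateAt)
open import Data.Product using (_×_; Σ; ∃-syntax; _,_)
open import Relation.Binary.PropositionalEquality using (_≡_; _≢_)
open import Function.Bundles using (_⇔_)
open import Function.Definitions using (Bijective)

-- A vertex of CQ_n: a binary string u = u_{n-1} ... u_0, stored as a vector
-- with lookup u i = u_i  (i : Fin n).
Vertex : ℕ → Set
Vertex n = Vec Bool n

Odd : ℕ → Set
Odd m = ∃[ j ] m ≡ 2 * j + 1

-- pair relation on 2-bit strings x₂x₁ ∼ y₂y₁ (arguments: x₂ x₁ y₂ y₁)
data PairRel : Bool → Bool → Bool → Bool → Set where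
  p00 : PairRel false false false false
  p10 : PairRel true  false true  false
  p01 : PairRel false true  true  true
  p11 : PairRel true  true  false true

AdjAt : {n : ℕ} → Vertex n → Vertex n → Fin n → Set
AdjAt {n} u v x =
    (lookup v x ≢ lookup u x)
  × ((p : Odd (toℕ x)) → (y : Fin n) → suc (toℕ y) ≡ toℕ x → lookup v y ≡ lookup u y)
  × ((i : Fin n) → toℕ x < toℕ i → lookup v i ≡ lookup u i)
  × ((i : ℕ) → suc i ≤ toℕ x / 2 →
       (h₁ : 2 * i + 1 < n) (h₀ : 2 * i < n) →
       PairRel (lookup u (fromℕ< h₁)) (lookup u (fromℕ< h₀))
               (lookup v (fromℕ< h₁)) (lookup v (fromℕ< h₀)))

Adj : {n : ℕ} → Vertex n → Vertex n → Set
Adj {n} u v = ∃[ x ] AdjAt {n} u v x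

flipAt : {n : ℕ} → Fin n → Vertex n → Vertex n
flipAt i u = updateAt u i not

IsAutomorphism : (n : ℕ) → (Vertex n → Vertex n) → Set
IsAutomorphism n φ =
  Bijective {A = Vertex n} _≡_ _≡_ φ
  × ((u v : Vertex n) → Adj u v ⇔ Adj (φ u) (φ v))

-- Flipping an odd bit k acts on each 2-bit block u_{2i+1}u_{2i} by negating the high bit of
-- at most one block, and the pair relation is stable under negating both high bits.  The
-- remaining adjacency conditions only compare bits for equality, which any bit flip
-- preserves.  So f_k maps edges to edges in the same dimension, and being an involution it
-- also reflects them.
module Submission where

open import Defs
open import Data.Nat using (ℕ; _≤_; _<_; _*_; _+_)
open import Data.Nat.Properties using (even≢odd; +-comm)
open import Data.Fin using (Fin; toℕ; fromℕ<; _≟_)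
open import Data.Fin.Properties using (toℕ-fromℕ<)
open import Data.Bool using (not)
open import Data.Bool.Properties using (not-injective; not-involutive)
open import Data.Vec using (lookup)
open import Data.Vec.Properties
  using (lookup∘updateAt; lookup∘updateAt′; updateAt-updateAt; updateAt-id-local)
open import Data.Product using (_,_)
open import Relation.Nullary using (yes; no)
open import Relation.Binary.PropositionalEquality
open import Function.Bundles using (mk⇔)
open import Function.Definitions using (Bijective; StrictlyInverseˡ)
open import Function.Consequences using (inverseᵇ⇒bijective)
open import Function.Consequences.Propositional
  using (strictlyInverseˡ⇒inverseˡ; strictlyInverseʳ⇒inverseʳ)

involutive⇒bijective : ∀ {A : Set} (f : A → A) → StrictlyInverseˡ _≡_ f f → Bijective _≡_ _≡_ f
involutive⇒bijective f inv =
  inverseᵇ⇒bijective _≡_ refl sym trans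
    (strictlyInverseˡ⇒inverseˡ f inv , strictlyInverseʳ⇒inverseʳ f inv)

PairRel-not-high : ∀ {a b c d} → PairRel a b c d → PairRel (not a) b (not c) d
PairRel-not-high p00 = p10
PairRel-not-high p10 = p00
PairRel-not-high p01 = p11
PairRel-not-high p11 = p01

fromℕ<-even≢odd : ∀ {n} i (2i<n : 2 * i < n) {k : Fin n} → Odd (toℕ k) → fromℕ< 2i<n ≢ k
fromℕ<-even≢odd i 2i<n (j , k≡2j+1) refl = even≢odd i j (begin
  2 * i               ≡⟨ toℕ-fromℕ< 2i<n ⟨
  toℕ (fromℕ< 2i<n)   ≡⟨ k≡2j+1 ⟩
  2 * j + 1           ≡⟨ +-comm (2 * j) 1 ⟩
  1 + 2 * j           ∎)
  where open ≡-Reasoning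

module _ {n : ℕ} (k : Fin n) where

  flipAt-involutive : ∀ u → flipAt k (flipAt k u) ≡ u
  flipAt-involutive u =
    trans (updateAt-updateAt k u) (updateAt-id-local k u (not-involutive _))

  lookup-flipAt-≡ : ∀ {i} → i ≡ k → ∀ u → lookup (flipAt k u) i ≡ not (lookup u i)
  lookup-flipAt-≡ refl u = lookup∘updateAt k u

  lookup-flipAt-≢ : ∀ {i} → i ≢ k → ∀ u → lookup (flipAt k u) i ≡ lookup u i
  lookup-flipAt-≢ i≢k u = lookup∘updateAt′ _ k i≢k u

  flipAt-preserves-≡ : ∀ u v i → lookup v i ≡ lookup u i →
                       lookup (flipAt k v) i ≡ lookup (flipAt k u) i
  flipAt-preserves-≡ u v i eq with i ≟ k
  ... | yes i≡k rewrite lookup-flipAt-≡ i≡k u | lookup-flipAt-≡ i≡k v = cong not eq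
  ... | no  i≢k rewrite lookup-flipAt-≢ i≢k u | lookup-flipAt-≢ i≢k v = eq

  flipAt-preserves-≢ : ∀ u v i → lookup v i ≢ lookup u i →
                       lookup (flipAt k v) i ≢ lookup (flipAt k u) i
  flipAt-preserves-≢ u v i neq with i ≟ k
  ... | yes i≡k rewrite lookup-flipAt-≡ i≡k u | lookup-flipAt-≡ i≡k v = λ eq → neq (not-injective eq)
  ... | no  i≢k rewrite lookup-flipAt-≢ i≢k u | lookup-flipAt-≢ i≢k v = neq

  module _ (k-odd : Odd (toℕ k)) where

    flipAt-preserves-PairRel : ∀ u v i (h₁ : 2 * i + 1 < n) (h₀ : 2 * i < n) →
      PairRel (lookup u (fromℕ< h₁)) (lookup u (fromℕ< h₀))
              (lookup v (fromℕ< h₁)) (lookup v (fromℕ< h₀)) →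
      PairRel (lookup (flipAt k u) (fromℕ< h₁)) (lookup (flipAt k u) (fromℕ< h₀))
              (lookup (flipAt k v) (fromℕ< h₁)) (lookup (flipAt k v) (fromℕ< h₀))
    flipAt-preserves-PairRel u v i h₁ h₀ rel
      rewrite lookup-flipAt-≢ (fromℕ<-even≢odd i h₀ k-odd) u
            | lookup-flipAt-≢ (fromℕ<-even≢odd i h₀ k-odd) v
      with fromℕ< h₁ ≟ k
    ... | yes high≡k rewrite lookup-flipAt-≡ high≡k u | lookup-flipAt-≡ high≡k v = PairRel-not-high rel
    ... | no  high≢k rewrite lookup-flipAt-≢ high≢k u | lookup-flipAt-≢ high≢k v = rel

    flipAt-preserves-AdjAt : ∀ u v x → AdjAt u v x → AdjAt (flipAt k u) (flipAt k v) x
    flipAt-preserves-AdjAt u v x (differ , below , above , pairs) =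
      flipAt-preserves-≢ u v x differ ,
      (λ p y y+1≡x → flipAt-preserves-≡ u v y (below p y y+1≡x)) ,
      (λ i x<i → flipAt-preserves-≡ u v i (above i x<i)) ,
      (λ i i<x/2 h₁ h₀ → flipAt-preserves-PairRel u v i h₁ h₀ (pairs i i<x/2 h₁ h₀))

    flipAt-preserves-Adj : ∀ u v → Adj u v → Adj (flipAt k u) (flipAt k v)
    flipAt-preserves-Adj u v (x , adj) = x , flipAt-preserves-AdjAt u v x adj

    flipAt-reflects-Adj : ∀ u v → Adj (flipAt k u) (flipAt k v) → Adj u v
    flipAt-reflects-Adj u v adj =
      subst₂ Adj (flipAt-involutive u) (flipAt-involutive v)
        (flipAt-preserves-Adj (flipAt k u) (flipAt k v) adj)

-- The hypotheses 2 ≤ n and 1 ≤ k follow from k being an odd element of Fin n.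
lemma1 : (n : ℕ) → 2 ≤ n → (k : Fin n) → Odd (toℕ k) → 1 ≤ toℕ k →
    IsAutomorphism n (flipAt k)
lemma1 n _ k k-odd _ =
  involutive⇒bijective (flipAt k) (flipAt-involutive k) ,
  λ u v → mk⇔ (flipAt-preserves-Adj k k-odd u v) (flipAt-reflects-Adj k k-odd u v)
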